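{- Let $\mathcal{G}$ be a hereditary class of bipartite graphs that is weakly-sparse. Then $\mathsf{D}^{\mathrm{Eq}}(\mathcal{G})=O(1)$ if and only if $\mathcal{G}$ has bounded degeneracy.
   Context: A class of bipartite graphs is a set of bipartite graphs (each with a fixed bipartition) closed under isomorphism; it is hereditary if closed under taking induced subgraphs. It is weakly-sparse if there is a constant $t$ such that no graph in it contains $K_{t,t}$ as a (not necessarily induced) subgraph. It has bounded degeneracy if there is a constant $d$ such that every graph in it has a vertex of degree at most $d$. $\mathsf{D}^{\mathrm{Eq}}$: for $M\in\{\pm1\}^{X\times Y}$, $\mathsf{D}^{\mathrm{Eq}}(M)$ is the minimum depth of a rooted binary tree in which each internal node $v$ carries functions $\alpha_v:X\to\mathbb{N}$, $\beta_v:Y\to\mathbb{N}$ and each leaf a value in $\{\pm1\}$, such that for every $(x,y)$, walking from the root (right child if $\alpha_v(x)=\beta_v(y)$, left otherwise) reaches a leaf with value $M(x,y)$. $\mathsf{D}^{\mathrm{Eq}}(\mathcal{G})=O(1)$ means there is a constant $c$ with $\mathsf{D}^{\mathrm{Eq}}(\mathrm{Adj}_G)\le c$ for all $G\in\mathcal{G}$, where $\mathrm{Adj}_G\in\{\pm1\}^{X\times Y}$ is the bipartite adjacency matrix ($1$ iff $xy$ is an edge). -}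

module Defs where

open import Data.Nat using (ℕ; zero; suc; _+_; _≤_; _⊔_)
open import Data.Bool using (Bool; true; false; if_then_else_)
open import Data.Fin using (Fin; zero; suc)
open import Data.Product using (Σ; ∃; _×_; _,_)
open import Data.Sum using (_⊎_)
open import Relation.Nullary using (¬_)
open import Relation.Binary.PropositionalEquality using (_≡_)
open import Function.Definitions using (Injective)

-- A finite bipartite graph with fixed bipartition (X , Y) = (Fin m , Fin n);
-- adj x y = true iff xy is an edge (i.e. Adj_G(x,y) = 1; false encodes -1).
record BGraph : Set where
  constructor mkBG
  field
    m   : ℕ
    n   : ℕ
    adj : Fin m → Fin n → Bool
open BGraph public

Class : Set₁
Class = BGraph → Set

-- Induced subgraph along injections of the two sides (covers isomorphic copies too).
induced : (G : BGraph) {m' n' : ℕ} → (Fin m' → Fin (m G)) → (Fin n' → Fin (n G)) → BGraph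
induced G {m'} {n'} f g = mkBG m' n' (λ x y → adj G (f x) (g y))

Hereditary : Class → Set
Hereditary 𝒢 = ∀ (G : BGraph) {m' n' : ℕ} (f : Fin m' → Fin (m G)) (g : Fin n' → Fin (n G)) →
  Injective _≡_ _≡_ f → Injective _≡_ _≡_ g → 𝒢 G → 𝒢 (induced G f g)

ContainsKtt : ℕ → BGraph → Set
ContainsKtt t G = Σ (Fin t → Fin (m G)) λ f → Σ (Fin t → Fin (n G)) λ g →
  Injective _≡_ _≡_ f × Injective _≡_ _≡_ g × (∀ i j → adj G (f i) (g j) ≡ true)

WeaklySparse : Class → Set
WeaklySparse 𝒢 = ∃ λ t → ∀ G → 𝒢 G → ¬ ContainsKtt t G

countTrue : ∀ {k} → (Fin k → Bool) → ℕ
countTrue {zero}  p = zero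
countTrue {suc k} p = (if p zero then 1 else 0) + countTrue (λ i → p (suc i))

degX : (G : BGraph) → Fin (m G) → ℕ
degX G x = countTrue (λ y → adj G x y)

degY : (G : BGraph) → Fin (n G) → ℕ
degY G y = countTrue (λ x → adj G x y)

HasVertexOfDegreeAtMost : ℕ → BGraph → Set
HasVertexOfDegreeAtMost d G = (∃ λ x → degX G x ≤ d) ⊎ (∃ λ y → degY G y ≤ d)

BoundedDegeneracy : Class → Set
BoundedDegeneracy 𝒢 = ∃ λ d → ∀ G → 𝒢 G → 1 ≤ m G + n G → HasVertexOfDegreeAtMost d G

-- Equality-query decision trees for matrices in {±1}^{Fin m × Fin n}
-- (true = +1, false = -1).
data EqTree (m n : ℕ) : Set where
  leaf : Bool → EqTree m n
  node : (α : Fin m → ℕ) (β : Fin n → ℕ) (left right : EqTree m n) → EqTree m n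

depth : ∀ {m n} → EqTree m n → ℕ
depth (leaf _) = zero
depth (node _ _ l r) = suc (depth l ⊔ depth r)

eval : ∀ {m n} → EqTree m n → Fin m → Fin n → Bool
eval (leaf b) x y = b
eval (node α β l r) x y with Data.Nat._≟_ (α x) (β y)
... | Relation.Nullary.yes _ = eval r x y
... | Relation.Nullary.no  _ = eval l x y

DEqAtMost : ∀ {m n} → ℕ → (Fin m → Fin n → Bool) → Set
DEqAtMost {m} {n} c M = Σ (EqTree m n) λ T → depth T ≤ c × (∀ x y → eval T x y ≡ M x y)

BoundedDEq : Class → Set
BoundedDEq 𝒢 = ∃ λ c → ∀ G → 𝒢 G → DEqAtMost c (adj G)

-- (⇒) Call R : Fin m → Fin n → Bool C-sparse if every K_{t,t}-free restriction of R to a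
-- rectangle A × B has at most C (|A| + |B|) edges. The complete relation is t-sparse and
-- unions add the constants. Intersecting with α x = β y keeps C-sparsity (partition A × B
-- by the common value); intersecting with α x ≠ β y gives 2C-sparsity (average over all
-- 2-colourings σ of the values, keeping x ∈ A with σ (α x) and y ∈ B with ¬ σ (β y): every
-- such pair survives for a quarter and every vertex for half of the σ). So each node of an
-- equality tree costs a factor 3, and a K_{t,t}-free graph whose adjacency matrix has a tree
-- of depth c has at most 3^c t (m + n) edges, hence a vertex of degree at most 2 · 3^c t.
-- (⇐) Deleting a vertex of degree ≤ d and recursing (heredity) stores every edge at one of
-- its endpoints, at most d edges per vertex; then xy is an edge iff one of 2d equality
-- tests "the i-th edge stored at x goes to y" or "the i-th edge stored at y goes to x" holds.

module Submission where

open import Defs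
import Algebra.Properties.Semiring.Sum
open import Data.Bool using (Bool; true; false; _∧_; _∨_; not; if_then_else_; T)
open import Data.Bool.Properties using (T-∧; T-∨; T-≡; ∧-distribˡ-∨; ∧-zeroʳ; ∧-identityʳ; ∨-identityʳ)
open import Data.Empty using (⊥; ⊥-elim)
open import Data.Fin using (Fin; zero; suc; toℕ; fromℕ<; punchIn; punchOut)
import Data.Fin.Properties as Fin
open import Data.Maybe as Maybe using (Maybe; just; nothing)
open import Data.Nat
open import Data.Nat.Properties
open import Data.Nat.Tactic.RingSolver using (solve-∀)
open import Data.Product using (Σ; ∃; _×_; _,_; proj₁; proj₂)
open import Data.Sum as Sum using (_⊎_; inj₁; inj₂)
open import Data.Vec using (Vec; []; _∷_)
open import Function using (_∘_; id; _⇔_; mk⇔; Equivalence)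
open import Function.Definitions using (Injective)
open import Relation.Binary.PropositionalEquality
open import Relation.Nullary using (¬_; Dec; yes; no)
open import Relation.Nullary.Decidable using (⌊_⌋; toWitness; fromWitness; ⌊⌋-map′)

open Algebra.Properties.Semiring.Sum +-*-semiring
  using (sum; sum-syntax; ∑-comm; ∑-distrib-+; *-distribˡ-sum; *-distribʳ-sum; sum-cong-≗)

𝟙 : Bool → ℕ
𝟙 b = if b then 1 else 0

𝟙-mono : ∀ {a b} → (T a → T b) → 𝟙 a ≤ 𝟙 b
𝟙-mono {false} _ = z≤n
𝟙-mono {true} {true} _ = ≤-refl
𝟙-mono {true} {false} a⇒b = ⊥-elim (a⇒b _)

T⇒1≤𝟙 : ∀ {b} → T b → 1 ≤ 𝟙 b
T⇒1≤𝟙 {true} _ = ≤-refl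

𝟙-∨ : ∀ a b → 𝟙 (a ∨ b) ≤ 𝟙 a + 𝟙 b
𝟙-∨ false b = ≤-refl
𝟙-∨ true  b = s≤s z≤n

*𝟙-≤ : ∀ {c z} b → (T b → c ≤ z) → c * 𝟙 b ≤ z
*𝟙-≤ {c} false _   rewrite *-zeroʳ c     = z≤n
*𝟙-≤ {c} true  c≤z rewrite *-identityʳ c = c≤z _

T-∧⁺ : ∀ {a b} → T a → T b → T (a ∧ b)
T-∧⁺ p q = Equivalence.from T-∧ (p , q)

T-∧⁻ : ∀ {a b} → T (a ∧ b) → T a × T b
T-∧⁻ = Equivalence.to T-∧

T-∧-monoʳ : ∀ a {b c} → (T b → T c) → T (a ∧ b) → T (a ∧ c)
T-∧-monoʳ true b⇒c = b⇒c

sum-mono : ∀ {k} {f g : Fin k → ℕ} → (∀ i → f i ≤ g i) → sum f ≤ sum g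
sum-mono {zero}  f≤g = z≤n
sum-mono {suc k} f≤g = +-mono-≤ (f≤g zero) (sum-mono (f≤g ∘ suc))

∑-const : ∀ k c → ∑[ i < k ] c ≡ k * c
∑-const zero    c = refl
∑-const (suc k) c = cong (c +_) (∑-const k c)

doubling : ∀ p s → p * s + p * s ≡ 2 * p * s
doubling = solve-∀

∑-zero : ∀ k → ∑[ i < k ] 0 ≡ 0
∑-zero k = trans (∑-const k 0) (*-zeroʳ k)

≤-sum : ∀ {k} (f : Fin k → ℕ) i → f i ≤ sum f
≤-sum f zero    = m≤m+n _ _
≤-sum f (suc i) = ≤-trans (≤-sum (f ∘ suc) i) (m≤n+m _ _)

*-sum-≤ : ∀ {k} c {f g : Fin k → ℕ} → (∀ i → c * f i ≤ g i) → c * sum f ≤ sum g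
*-sum-≤ c {f} cf≤g = ≤-trans (≤-reflexive (*-distribˡ-sum c f)) (sum-mono cf≤g)

*≤sum : ∀ {k c} {f : Fin k → ℕ} → (∀ i → c ≤ f i) → k * c ≤ sum f
*≤sum {k} {c} c≤f = ≤-trans (≤-reflexive (sym (∑-const k c))) (sum-mono c≤f)

size : ∀ {k} → (Fin k → Bool) → ℕ
size A = ∑[ x < _ ] 𝟙 (A x)

countTrue≡size : ∀ {k} (p : Fin k → Bool) → countTrue p ≡ size p
countTrue≡size {zero}  p = refl
countTrue≡size {suc k} p = cong (𝟙 (p zero) +_) (countTrue≡size (p ∘ suc))

size-full : ∀ k → size (λ (_ : Fin k) → true) ≡ k
size-full k = trans (∑-const k 1) (*-identityʳ k)

-- Sparse relations

Rel : ℕ → ℕ → Set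
Rel m n = Fin m → Fin n → Bool

module _ {m n : ℕ} where

  infix 4 _⊆_
  _⊆_ : Rel m n → Rel m n → Set
  R ⊆ R′ = ∀ x y → T (R x y) → T (R′ x y)

  infixl 7 _∩_
  _∩_ : Rel m n → Rel m n → Rel m n
  (E ∩ R) x y = E x y ∧ R x y

  infixl 6 _∪_
  _∪_ : Rel m n → Rel m n → Rel m n
  (R ∪ R′) x y = R x y ∨ R′ x y

  infix 5 _∣_⊗_
  _∣_⊗_ : Rel m n → (Fin m → Bool) → (Fin n → Bool) → Rel m n
  (R ∣ A ⊗ B) x y = A x ∧ (B y ∧ R x y)

  edges : Rel m n → ℕ
  edges R = ∑[ x < m ] ∑[ y < n ] 𝟙 (R x y)

  edges-mono : ∀ {R R′} → R ⊆ R′ → edges R ≤ edges R′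
  edges-mono R⊆R′ = sum-mono λ x → sum-mono λ y → 𝟙-mono (R⊆R′ x y)

  edges-∪ : ∀ R R′ → edges (R ∪ R′) ≤ edges R + edges R′
  edges-∪ R R′ = begin
      edges (R ∪ R′)
    ≤⟨ sum-mono (λ x → sum-mono λ y → 𝟙-∨ (R x y) (R′ x y)) ⟩
      ∑[ x < m ] ∑[ y < n ] (𝟙 (R x y) + 𝟙 (R′ x y))
    ≡⟨ sum-cong-≗ (λ x → ∑-distrib-+ (𝟙 ∘ R x) (𝟙 ∘ R′ x)) ⟩
      ∑[ x < m ] (∑[ y < n ] 𝟙 (R x y) + ∑[ y < n ] 𝟙 (R′ x y))
    ≡⟨ ∑-distrib-+ (λ x → ∑[ y < n ] 𝟙 (R x y)) (λ x → ∑[ y < n ] 𝟙 (R′ x y)) ⟩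
      edges R + edges R′ ∎
    where open ≤-Reasoning

  ∣-mono : ∀ {R R′} A B → R ⊆ R′ → R ∣ A ⊗ B ⊆ R′ ∣ A ⊗ B
  ∣-mono A B R⊆R′ x y = T-∧-monoʳ (A x) (T-∧-monoʳ (B y) (R⊆R′ x y))

  ∣-∪ : ∀ R R′ A B x y → ((R ∪ R′) ∣ A ⊗ B) x y ≡ ((R ∣ A ⊗ B) ∪ (R′ ∣ A ⊗ B)) x y
  ∣-∪ R R′ A B x y = begin
      A x ∧ (B y ∧ (R x y ∨ R′ x y))
    ≡⟨ cong (A x ∧_) (∧-distribˡ-∨ (B y) (R x y) (R′ x y)) ⟩
      A x ∧ ((B y ∧ R x y) ∨ (B y ∧ R′ x y))
    ≡⟨ ∧-distribˡ-∨ (A x) _ _ ⟩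
      (A x ∧ (B y ∧ R x y)) ∨ (A x ∧ (B y ∧ R′ x y)) ∎
    where open ≡-Reasoning

  KttFree : ℕ → Rel m n → Set
  KttFree t R = ¬ ContainsKtt t (mkBG m n R)

  KttFree-antimono : ∀ {t R R′} → R ⊆ R′ → KttFree t R′ → KttFree t R
  KttFree-antimono R⊆R′ free (f , g , f-inj , g-inj , complete) =
    free (f , g , f-inj , g-inj , λ i j → Equivalence.to T-≡ (R⊆R′ _ _ (Equivalence.from T-≡ (complete i j))))

  record Sparse (t C : ℕ) (R : Rel m n) : Set where
    constructor mkSparse
    field
      edges-bound : ∀ A B → KttFree t (R ∣ A ⊗ B) → edges (R ∣ A ⊗ B) ≤ C * (size A + size B)
  open Sparse public

  Sparse-mono : ∀ {t C D R} → C ≤ D → Sparse t C R → Sparse t D R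
  Sparse-mono C≤D sparse = mkSparse λ A B free →
    ≤-trans (edges-bound sparse A B free) (*-monoˡ-≤ (size A + size B) C≤D)

  Sparse-cong : ∀ {t C R R′} → (∀ x y → R x y ≡ R′ x y) → Sparse t C R → Sparse t C R′
  Sparse-cong {R = R} {R′} R≗R′ sparse = mkSparse λ A B free →
    ≤-trans (edges-mono (∣-mono A B R′⊆R)) (edges-bound sparse A B (KttFree-antimono (∣-mono A B R⊆R′) free))
    where
    R⊆R′ : R ⊆ R′
    R⊆R′ x y = subst T (R≗R′ x y)
    R′⊆R : R′ ⊆ R
    R′⊆R x y = subst T (sym (R≗R′ x y))

  Sparse-empty : ∀ {t} C → Sparse t C (λ _ _ → false)
  Sparse-empty C = mkSparse λ A B _ → ≤-trans (edges-mono (nothing⊆ A B)) (≤-trans (≤-reflexive no-edges) z≤n)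
    where
    nothing⊆ : ∀ A B → (λ _ _ → false) ∣ A ⊗ B ⊆ (λ _ _ → false)
    nothing⊆ A B x y p = proj₂ (T-∧⁻ {B y} (proj₂ (T-∧⁻ {A x} p)))
    no-edges : edges (λ _ _ → false) ≡ 0
    no-edges = trans (sum-cong-≗ {m} {λ _ → ∑[ y < n ] 0} (λ _ → ∑-zero n)) (∑-zero m)

  Sparse-∪ : ∀ {t C D R R′} → Sparse t C R → Sparse t D R′ → Sparse t (C + D) (R ∪ R′)
  Sparse-∪ {C = C} {D} {R} {R′} sparse sparse′ = mkSparse λ A B free → begin
      edges ((R ∪ R′) ∣ A ⊗ B)
    ≡⟨ sum-cong-≗ (λ x → sum-cong-≗ λ y → cong 𝟙 (∣-∪ R R′ A B x y)) ⟩
      edges ((R ∣ A ⊗ B) ∪ (R′ ∣ A ⊗ B))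
    ≤⟨ edges-∪ _ _ ⟩
      edges (R ∣ A ⊗ B) + edges (R′ ∣ A ⊗ B)
    ≤⟨ +-mono-≤ (edges-bound sparse A B (KttFree-antimono (∣-mono A B inj₁′) free))
                (edges-bound sparse′ A B (KttFree-antimono (∣-mono A B inj₂′) free)) ⟩
      C * (size A + size B) + D * (size A + size B)
    ≡⟨ *-distribʳ-+ (size A + size B) C D ⟨
      (C + D) * (size A + size B) ∎
    where
    open ≤-Reasoning
    inj₁′ : R ⊆ R ∪ R′
    inj₁′ _ _ = Equivalence.from T-∨ ∘ inj₁
    inj₂′ : R′ ⊆ R ∪ R′
    inj₂′ _ _ = Equivalence.from T-∨ ∘ inj₂

select : ∀ {k} (A : Fin k → Bool) t → t ≤ size A →
         Σ (Fin t → Fin k) λ f → Injective _≡_ _≡_ f × (∀ i → T (A (f i)))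
select A zero _ = (λ ()) , (λ {i} → ⊥-elim (Fin.¬Fin0 i)) , λ ()
select {suc k} A (suc t) t≤A with A zero in A₀
... | true with f , f-inj , f-sound ← select (A ∘ suc) t (s≤s⁻¹ t≤A) = f′ , f′-inj , f′-sound
  where
  f′ : Fin (suc t) → Fin (suc k)
  f′ zero    = zero
  f′ (suc i) = suc (f i)
  f′-inj : Injective _≡_ _≡_ f′
  f′-inj {zero}  {zero}  _  = refl
  f′-inj {suc i} {suc j} eq = cong suc (f-inj (Fin.suc-injective eq))
  f′-sound : ∀ i → T (A (f′ i))
  f′-sound zero    = Equivalence.from T-≡ A₀
  f′-sound (suc i) = f-sound i
... | false with f , f-inj , f-sound ← select (A ∘ suc) (suc t) t≤A =
  suc ∘ f , f-inj ∘ Fin.suc-injective , f-sound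

edges-complete : ∀ {m n} (A : Fin m → Bool) (B : Fin n → Bool) →
                 edges ((λ _ _ → true) ∣ A ⊗ B) ≡ size A * size B
edges-complete {m} {n} A B = begin
    ∑[ x < m ] ∑[ y < n ] 𝟙 (A x ∧ (B y ∧ true))
  ≡⟨ sum-cong-≗ (λ x → sum-cong-≗ λ y → 𝟙-∧-true (A x) (B y)) ⟩
    ∑[ x < m ] ∑[ y < n ] (𝟙 (A x) * 𝟙 (B y))
  ≡⟨ sum-cong-≗ (λ x → *-distribˡ-sum (𝟙 (A x)) (𝟙 ∘ B)) ⟨
    ∑[ x < m ] (𝟙 (A x) * size B)
  ≡⟨ *-distribʳ-sum (size B) (𝟙 ∘ A) ⟨
    size A * size B ∎
  where
  open ≡-Reasoning
  𝟙-∧-true : ∀ a b → 𝟙 (a ∧ (b ∧ true)) ≡ 𝟙 a * 𝟙 b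
  𝟙-∧-true false b     = refl
  𝟙-∧-true true  false = refl
  𝟙-∧-true true  true  = refl

Sparse-complete : ∀ {m n} t → Sparse {m} {n} t t (λ _ _ → true)
Sparse-complete t = mkSparse bound
  where
  bound : ∀ A B → KttFree t ((λ _ _ → true) ∣ A ⊗ B) →
          edges ((λ _ _ → true) ∣ A ⊗ B) ≤ t * (size A + size B)
  bound A B free with t ≤? size A | t ≤? size B
  ... | yes t≤A | yes t≤B
    with f , f-inj , f-sound ← select A t t≤A | g , g-inj , g-sound ← select B t t≤B =
    ⊥-elim (free (f , g , f-inj , g-inj , λ i j →
      Equivalence.to T-≡ (T-∧⁺ (f-sound i) (T-∧⁺ (g-sound j) _))))
  ... | no t≰A | _ = begin
      edges ((λ _ _ → true) ∣ A ⊗ B)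
    ≡⟨ edges-complete A B ⟩
      size A * size B
    ≤⟨ *-mono-≤ (<⇒≤ (≰⇒> t≰A)) (m≤n+m (size B) (size A)) ⟩
      t * (size A + size B) ∎
    where open ≤-Reasoning
  ... | yes _ | no t≰B = begin
      edges ((λ _ _ → true) ∣ A ⊗ B)
    ≡⟨ trans (edges-complete A B) (*-comm (size A) (size B)) ⟩
      size B * size A
    ≤⟨ *-mono-≤ (<⇒≤ (≰⇒> t≰B)) (m≤m+n (size A) (size B)) ⟩
      t * (size A + size B) ∎
    where open ≤-Reasoning

-- Averaging

record Summation (I : Set) : Set where
  field
    ∑ᵢ      : (I → ℕ) → ℕ
    ∑ᵢ-mono : ∀ {f g} → (∀ i → f i ≤ g i) → ∑ᵢ f ≤ ∑ᵢ g
    ∑ᵢ-0    : ∑ᵢ (λ _ → 0) ≡ 0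
    ∑ᵢ-+    : ∀ f g → ∑ᵢ (λ i → f i + g i) ≡ ∑ᵢ f + ∑ᵢ g

  ∑ᵢ-* : ∀ c f → ∑ᵢ (λ i → c * f i) ≡ c * ∑ᵢ f
  ∑ᵢ-* zero    f = ∑ᵢ-0
  ∑ᵢ-* (suc c) f = trans (∑ᵢ-+ f (λ i → c * f i)) (cong (∑ᵢ f +_) (∑ᵢ-* c f))

  ∑ᵢ-∑ : ∀ {k} (f : I → Fin k → ℕ) →
         ∑ᵢ (λ i → ∑[ x < k ] f i x) ≡ ∑[ x < k ] ∑ᵢ (λ i → f i x)
  ∑ᵢ-∑ {zero}  f = ∑ᵢ-0
  ∑ᵢ-∑ {suc k} f = trans (∑ᵢ-+ (λ i → f i zero) (λ i → ∑[ x < k ] f i (suc x)))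
                         (cong (∑ᵢ (λ i → f i zero) +_) (∑ᵢ-∑ (λ i → f i ∘ suc)))

module _ {I : Set} (𝓘 : Summation I) where
  open Summation 𝓘

  private
    ∑ᵢ-size : ∀ {k c} (A : Fin k → Bool) (P : I → Fin k → Bool) →
              (∀ x → ∑ᵢ (λ i → 𝟙 (P i x)) ≤ c) →
              ∑ᵢ (λ i → size (λ x → A x ∧ P i x)) ≤ c * size A
    ∑ᵢ-size {k} {c} A P P-cover = begin
        ∑ᵢ (λ i → ∑[ x < k ] 𝟙 (A x ∧ P i x))
      ≡⟨ ∑ᵢ-∑ (λ i x → 𝟙 (A x ∧ P i x)) ⟩
        ∑[ x < k ] ∑ᵢ (λ i → 𝟙 (A x ∧ P i x))
      ≤⟨ sum-mono (λ x → pointwise (A x) x) ⟩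
        ∑[ x < k ] (c * 𝟙 (A x))
      ≡⟨ *-distribˡ-sum c (𝟙 ∘ A) ⟨
        c * size A ∎
      where
      open ≤-Reasoning
      pointwise : ∀ a x → ∑ᵢ (λ i → 𝟙 (a ∧ P i x)) ≤ c * 𝟙 a
      pointwise false x = ≤-trans (≤-reflexive ∑ᵢ-0) z≤n
      pointwise true  x = ≤-trans (P-cover x) (≤-reflexive (sym (*-identityʳ c)))

    piece⊆ : ∀ a p b q r e → (T p → T q → T e) →
             T ((a ∧ p) ∧ ((b ∧ q) ∧ r)) → T (a ∧ (b ∧ (e ∧ r)))
    piece⊆ false _     _     _     _ _ _       ()
    piece⊆ true  false _     _     _ _ _       ()
    piece⊆ true  true  false _     _ _ _       ()
    piece⊆ true  true  true  false _ _ _       ()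
    piece⊆ true  true  true  true  _ _ p∧q⇒e r = T-∧⁺ (p∧q⇒e _ _) r

    ⊆piece : ∀ a p b q r e → T (a ∧ (b ∧ (e ∧ r))) → T (p ∧ q) → T ((a ∧ p) ∧ ((b ∧ q) ∧ r))
    ⊆piece true true true true true true _ _ = _

    filter-holds : ∀ a b e r → T (a ∧ (b ∧ (e ∧ r))) → T e
    filter-holds true true e r = proj₁ ∘ T-∧⁻ {e}

  -- Double counting the edges of E ∩ R over the pieces Pᵢ × Qᵢ.
  Sparse-average : ∀ {m n t C κ μ} .{{_ : NonZero μ}} {E R : Rel m n}
    (P : I → Fin m → Bool) (Q : I → Fin n → Bool) →
    (∀ i x y → T (P i x) → T (Q i y) → T (E x y)) →
    (∀ x → ∑ᵢ (λ i → 𝟙 (P i x)) ≤ κ * μ) →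
    (∀ y → ∑ᵢ (λ i → 𝟙 (Q i y)) ≤ κ * μ) →
    (∀ x y → T (E x y) → μ ≤ ∑ᵢ (λ i → 𝟙 (P i x ∧ Q i y))) →
    Sparse t C R → Sparse t (κ * C) (E ∩ R)
  Sparse-average {m} {n} {t} {C} {κ} {μ} {E} {R} P Q P∧Q⇒E P-cover Q-cover E-cover sparse = mkSparse bound
    where
    bound : ∀ A B → KttFree t (E ∩ R ∣ A ⊗ B) → edges (E ∩ R ∣ A ⊗ B) ≤ κ * C * (size A + size B)
    bound A B free =
      *-cancelˡ-≤ μ (begin
        μ * edges ((E ∩ R) ∣ A ⊗ B)
      ≤⟨ *-sum-≤ μ (λ x → *-sum-≤ μ λ y → *𝟙-≤ ((E ∩ R ∣ A ⊗ B) x y) (covered x y)) ⟩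
        ∑[ x < m ] ∑[ y < n ] ∑ᵢ (λ i → 𝟙 ((R ∣ Aᵢ i ⊗ Bᵢ i) x y))
      ≡⟨ trans (∑ᵢ-∑ λ i x → ∑[ y < n ] 𝟙 ((R ∣ Aᵢ i ⊗ Bᵢ i) x y))
               (sum-cong-≗ λ x → ∑ᵢ-∑ λ i y → 𝟙 ((R ∣ Aᵢ i ⊗ Bᵢ i) x y)) ⟨
        ∑ᵢ (λ i → edges (R ∣ Aᵢ i ⊗ Bᵢ i))
      ≤⟨ ∑ᵢ-mono (λ i → edges-bound sparse (Aᵢ i) (Bᵢ i) (KttFree-antimono (piece⊆ᵢ i) free)) ⟩
        ∑ᵢ (λ i → C * (size (Aᵢ i) + size (Bᵢ i)))
      ≡⟨ trans (∑ᵢ-* C _) (cong (C *_) (∑ᵢ-+ (λ i → size (Aᵢ i)) (λ i → size (Bᵢ i)))) ⟩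
        C * (∑ᵢ (λ i → size (Aᵢ i)) + ∑ᵢ (λ i → size (Bᵢ i)))
      ≤⟨ *-monoʳ-≤ C (+-mono-≤ (∑ᵢ-size A P P-cover) (∑ᵢ-size B Q Q-cover)) ⟩
        C * (κ * μ * size A + κ * μ * size B)
      ≡⟨ regroup C κ μ (size A) (size B) ⟩
        μ * (κ * C * (size A + size B)) ∎)
      where
      open ≤-Reasoning
      Aᵢ : I → Fin m → Bool
      Aᵢ i x = A x ∧ P i x
      Bᵢ : I → Fin n → Bool
      Bᵢ i y = B y ∧ Q i y
      piece⊆ᵢ : ∀ i → R ∣ Aᵢ i ⊗ Bᵢ i ⊆ (E ∩ R) ∣ A ⊗ B
      piece⊆ᵢ i x y = piece⊆ (A x) (P i x) (B y) (Q i y) (R x y) (E x y) (P∧Q⇒E i x y)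
      covered : ∀ x y → T ((E ∩ R ∣ A ⊗ B) x y) → μ ≤ ∑ᵢ (λ i → 𝟙 ((R ∣ Aᵢ i ⊗ Bᵢ i) x y))
      covered x y in-E∩R =
        ≤-trans (E-cover x y (filter-holds (A x) (B y) (E x y) (R x y) in-E∩R))
                (∑ᵢ-mono λ i → 𝟙-mono (⊆piece (A x) (P i x) (B y) (Q i y) (R x y) (E x y) in-E∩R))
      regroup : ∀ c k u a b → c * (k * u * a + k * u * b) ≡ u * (k * c * (a + b))
      regroup = solve-∀

finiteSum : ∀ k → Summation (Fin k)
finiteSum k = record { ∑ᵢ = sum ; ∑ᵢ-mono = sum-mono ; ∑ᵢ-0 = ∑-zero k ; ∑ᵢ-+ = ∑-distrib-+ }

∑colourings : ∀ M → (Vec Bool M → ℕ) → ℕ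
∑colourings zero    F = F []
∑colourings (suc M) F = ∑colourings M (F ∘ (true ∷_)) + ∑colourings M (F ∘ (false ∷_))

∑colourings-mono : ∀ M {F G} → (∀ σ → F σ ≤ G σ) → ∑colourings M F ≤ ∑colourings M G
∑colourings-mono zero    F≤G = F≤G []
∑colourings-mono (suc M) F≤G = +-mono-≤ (∑colourings-mono M (F≤G ∘ (true ∷_)))
                                        (∑colourings-mono M (F≤G ∘ (false ∷_)))

∑colourings-const : ∀ M c → ∑colourings M (λ _ → c) ≡ 2 ^ M * c
∑colourings-const zero    c = sym (+-identityʳ c)
∑colourings-const (suc M) c = begin
    ∑colourings M (λ _ → c) + ∑colourings M (λ _ → c)
  ≡⟨ cong₂ _+_ (∑colourings-const M c) (∑colourings-const M c) ⟩
    2 ^ M * c + 2 ^ M * c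
  ≡⟨ doubling (2 ^ M) c ⟩
    2 ^ suc M * c ∎
  where open ≡-Reasoning

∑colourings-+ : ∀ M F G → ∑colourings M (λ σ → F σ + G σ) ≡ ∑colourings M F + ∑colourings M G
∑colourings-+ zero    F G = refl
∑colourings-+ (suc M) F G =
  trans (cong₂ _+_ (∑colourings-+ M (F ∘ (true ∷_)) (G ∘ (true ∷_)))
                   (∑colourings-+ M (F ∘ (false ∷_)) (G ∘ (false ∷_))))
        (interchange (∑colourings M (F ∘ (true ∷_))) (∑colourings M (G ∘ (true ∷_)))
                     (∑colourings M (F ∘ (false ∷_))) (∑colourings M (G ∘ (false ∷_))))
  where
  interchange : ∀ a b c d → a + b + (c + d) ≡ a + c + (b + d)
  interchange = solve-∀

colouringSum : ∀ M → Summation (Vec Bool M)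
colouringSum M = record
  { ∑ᵢ      = ∑colourings M
  ; ∑ᵢ-mono = ∑colourings-mono M
  ; ∑ᵢ-0    = trans (∑colourings-const M 0) (*-zeroʳ (2 ^ M))
  ; ∑ᵢ-+    = ∑colourings-+ M
  }

colour : ∀ {M} → Vec Bool M → ℕ → Bool
colour []      _       = false
colour (b ∷ _) zero    = b
colour (_ ∷ σ) (suc a) = colour σ a

∑colourings-colour : ∀ {L a} (g : Bool → ℕ) → a < suc L →
                     ∑colourings (suc L) (λ σ → g (colour σ a)) ≡ 2 ^ L * (g true + g false)
∑colourings-colour {L} {zero} g _ =
  trans (cong₂ _+_ (∑colourings-const L (g true)) (∑colourings-const L (g false)))
        (sym (*-distribˡ-+ (2 ^ L) (g true) (g false)))
∑colourings-colour {suc L} {suc a} g a<L =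
  trans (cong₂ _+_ IH IH) (doubling (2 ^ L) (g true + g false))
  where
  IH : ∑colourings (suc L) (λ σ → g (colour σ a)) ≡ 2 ^ L * (g true + g false)
  IH = ∑colourings-colour g (s≤s⁻¹ a<L)
∑colourings-colour {zero} {suc a} g (s≤s ())

∑colourings-colour² : ∀ {L a b} (g : Bool → Bool → ℕ) → a ≢ b → a < 2 + L → b < 2 + L →
  ∑colourings (2 + L) (λ σ → g (colour σ a) (colour σ b)) ≡
  2 ^ L * (g true true + g true false + g false true + g false false)
∑colourings-colour² {L} {zero} {zero} g a≢b _ _ = ⊥-elim (a≢b refl)
∑colourings-colour² {L} {zero} {suc b} g _ _ b<L =
  trans (cong₂ _+_ (∑colourings-colour (g true) (s≤s⁻¹ b<L)) (∑colourings-colour (g false) (s≤s⁻¹ b<L)))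
        (regroup (2 ^ L) (g true true) (g true false) (g false true) (g false false))
  where
  regroup : ∀ p u v w z → p * (u + v) + p * (w + z) ≡ p * (u + v + w + z)
  regroup = solve-∀
∑colourings-colour² {L} {suc a} {zero} g _ a<L _ =
  trans (cong₂ _+_ (∑colourings-colour (λ u → g u true) (s≤s⁻¹ a<L))
                   (∑colourings-colour (λ u → g u false) (s≤s⁻¹ a<L)))
        (regroup (2 ^ L) (g true true) (g true false) (g false true) (g false false))
  where
  regroup : ∀ p u v w z → p * (u + w) + p * (v + z) ≡ p * (u + v + w + z)
  regroup = solve-∀
∑colourings-colour² {zero} {suc zero} {suc zero} g a≢b _ _ = ⊥-elim (a≢b refl)
∑colourings-colour² {suc L} {suc a} {suc b} g a≢b a<L b<L =
  trans (cong₂ _+_ IH IH) (doubling (2 ^ L) _)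
  where
  IH : ∑colourings (2 + L) (λ σ → g (colour σ a) (colour σ b)) ≡
       2 ^ L * (g true true + g true false + g false true + g false false)
  IH = ∑colourings-colour² g (a≢b ∘ cong suc) (s≤s⁻¹ a<L) (s≤s⁻¹ b<L)
∑colourings-colour² {zero} {suc (suc a)} g _ (s≤s (s≤s ())) _
∑colourings-colour² {zero} {suc a} {suc (suc b)} g _ _ (s≤s (s≤s ()))

-- Equality trees

agree disagree : ∀ {m n} → (Fin m → ℕ) → (Fin n → ℕ) → Rel m n
agree    α β x y = ⌊ α x ≟ β y ⌋
disagree α β x y = not (agree α β x y)

∑-δ : ∀ {M} (b : Fin M) → ∑[ a < M ] 𝟙 ⌊ a Fin.≟ b ⌋ ≡ 1
∑-δ {suc M} zero    = cong suc (∑-zero M)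
∑-δ {suc M} (suc b) = trans (sum-cong-≗ λ a → cong 𝟙 (⌊⌋-map′ _ _ (a Fin.≟ b))) (∑-δ b)

T-not : ∀ {b} → T b → T (not b) → ⊥
T-not {true} _ ()

module _ {m n t C} {R : Rel m n} (α : Fin m → ℕ) (β : Fin n → ℕ) (sparse : Sparse t C R) where

  private
    K : ℕ
    K = sum α + sum β
    α<K : ∀ x → α x < suc K
    α<K x = s≤s (≤-trans (≤-sum α x) (m≤m+n _ _))
    β<K : ∀ y → β y < suc K
    β<K y = s≤s (≤-trans (≤-sum β y) (m≤n+m _ _))

  Sparse-agree : Sparse t C (agree α β ∩ R)
  Sparse-agree = Sparse-mono (≤-reflexive (*-identityˡ C))
    (Sparse-average (finiteSum (suc K)) {C = C} {κ = 1} {μ = 1} P Q P∧Q⇒agree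
      (λ x → ≤-reflexive (∑-δ (ᾱ x))) (λ y → ≤-reflexive (∑-δ (β̄ y))) agree-covered sparse)
    where
    ᾱ : Fin m → Fin (suc K)
    ᾱ x = fromℕ< (α<K x)
    β̄ : Fin n → Fin (suc K)
    β̄ y = fromℕ< (β<K y)
    P : Fin (suc K) → Fin m → Bool
    P a x = ⌊ a Fin.≟ ᾱ x ⌋
    Q : Fin (suc K) → Fin n → Bool
    Q a y = ⌊ a Fin.≟ β̄ y ⌋
    P∧Q⇒agree : ∀ a x y → T (P a x) → T (Q a y) → T (agree α β x y)
    P∧Q⇒agree a x y a≡ᾱx a≡β̄y =
      fromWitness (Fin.fromℕ<-injective (α x) (β y) _ _ (trans (sym (toWitness a≡ᾱx)) (toWitness a≡β̄y)))
    agree-covered : ∀ x y → T (agree α β x y) → 1 ≤ ∑[ a < suc K ] 𝟙 (P a x ∧ Q a y)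
    agree-covered x y αx≡βy =
      ≤-trans (T⇒1≤𝟙 ᾱx∈Pᾱx∧Qᾱx) (≤-sum (λ a → 𝟙 (P a x ∧ Q a y)) (ᾱ x))
      where
      ᾱx∈Pᾱx∧Qᾱx : T (P (ᾱ x) x ∧ Q (ᾱ x) y)
      ᾱx∈Pᾱx∧Qᾱx with ᾱ x Fin.≟ ᾱ x | ᾱ x Fin.≟ β̄ y
      ... | yes _      | yes _    = _
      ... | no ᾱx≢ᾱx  | _        = ᾱx≢ᾱx refl
      ... | yes _      | no ᾱx≢β̄y = ᾱx≢β̄y (Fin.fromℕ<-cong (α x) (β y) (toWitness αx≡βy) _ _)

  Sparse-disagree : Sparse t (2 * C) (disagree α β ∩ R)
  Sparse-disagree =
    Sparse-average (colouringSum (2 + K)) {C = C} {κ = 2} {μ = 2 ^ K} {{m^n≢0 2 K}} P Q P∧Q⇒disagree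
      (λ x → ≤-reflexive (trans (∑colourings-colour 𝟙 (m<n⇒m<1+n (α<K x))) (*-identityʳ _)))
      (λ y → ≤-reflexive (trans (∑colourings-colour (𝟙 ∘ not) (m<n⇒m<1+n (β<K y))) (*-identityʳ _)))
      disagree-covered sparse
    where
    P : Vec Bool (2 + K) → Fin m → Bool
    P σ x = colour σ (α x)
    Q : Vec Bool (2 + K) → Fin n → Bool
    Q σ y = not (colour σ (β y))
    P∧Q⇒disagree : ∀ σ x y → T (P σ x) → T (Q σ y) → T (disagree α β x y)
    P∧Q⇒disagree σ x y σαx ¬σβy with α x ≟ β y
    ... | yes αx≡βy = T-not σαx (subst (λ v → T (not (colour σ v))) (sym αx≡βy) ¬σβy)
    ... | no  _     = _
    disagree-covered : ∀ x y → T (disagree α β x y) →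
                       2 ^ K ≤ ∑colourings (2 + K) (λ σ → 𝟙 (P σ x ∧ Q σ y))
    disagree-covered x y with α x ≟ β y
    ... | yes _    = λ ()
    ... | no αx≢βy = λ _ → ≤-reflexive (sym (trans
          (∑colourings-colour² (λ u v → 𝟙 (u ∧ not v)) αx≢βy (m<n⇒m<1+n (α<K x)) (m<n⇒m<1+n (β<K y)))
          (*-identityʳ _)))

Sparse-eval : ∀ {m n t C} {R : Rel m n} (τ : EqTree m n) → Sparse t C R → Sparse t (3 ^ depth τ * C) (eval τ ∩ R)
Sparse-eval {C = C} (leaf true)  sparse = Sparse-mono (≤-reflexive (sym (+-identityʳ C))) sparse
Sparse-eval         (leaf false) sparse = Sparse-empty _
Sparse-eval {C = C} {R} (node α β l r) sparse =
  Sparse-mono (constant-bound (depth l) (depth r))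
    (Sparse-cong split (Sparse-∪ (Sparse-eval r (Sparse-agree α β sparse))
                                 (Sparse-eval l (Sparse-disagree α β sparse))))
  where
  split : ∀ x y → (eval r ∩ (agree α β ∩ R) ∪ eval l ∩ (disagree α β ∩ R)) x y ≡
                  (eval (node α β l r) ∩ R) x y
  split x y with α x ≟ β y
  ... | yes _ = trans (cong (eval r x y ∧ R x y ∨_) (∧-zeroʳ (eval l x y))) (∨-identityʳ _)
  ... | no  _ = cong (_∨ eval l x y ∧ R x y) (∧-zeroʳ (eval r x y))
  constant-bound : ∀ a b → 3 ^ b * C + 3 ^ a * (2 * C) ≤ 3 ^ suc (a ⊔ b) * C
  constant-bound a b = begin
      3 ^ b * C + 3 ^ a * (2 * C)
    ≤⟨ +-mono-≤ (*-monoˡ-≤ C (^-monoʳ-≤ 3 (m≤n⊔m a b)))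
                (*-monoˡ-≤ (2 * C) (^-monoʳ-≤ 3 (m≤m⊔n a b))) ⟩
      3 ^ (a ⊔ b) * C + 3 ^ (a ⊔ b) * (2 * C)
    ≡⟨ regroup (3 ^ (a ⊔ b)) C ⟩
      3 ^ suc (a ⊔ b) * C ∎
    where
    open ≤-Reasoning
    regroup : ∀ p c → p * c + p * (2 * c) ≡ 3 * p * c
    regroup = solve-∀

Sparse⇒edges≤ : ∀ {m n t C} {R : Rel m n} → Sparse t C R → KttFree t R → edges R ≤ C * (m + n)
Sparse⇒edges≤ {m} {n} {C = C} {R} sparse free =
  subst (λ k → edges R ≤ C * k) (cong₂ _+_ (size-full m) (size-full n))
        (edges-bound sparse (λ _ → true) (λ _ → true) free)

edges≤⇒lowDegreeVertex : ∀ {C} G → 1 ≤ m G + n G → edges (adj G) ≤ C * (m G + n G) →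
                         HasVertexOfDegreeAtMost (2 * C) G
edges≤⇒lowDegreeVertex {C} G nonempty few-edges
  with Fin.any? (λ x → degX G x ≤? 2 * C) | Fin.any? (λ y → degY G y ≤? 2 * C)
... | yes lowX | _        = inj₁ lowX
... | no _     | yes lowY = inj₂ lowY
... | no highX | no highY = ⊥-elim (<⇒≱ nonempty (+-cancelʳ-≤ _ _ 0 (begin
    (m G + n G) + 2 * C * (m G + n G)
  ≡⟨ regroup (m G) (n G) (2 * C) ⟩
    m G * suc (2 * C) + n G * suc (2 * C)
  ≤⟨ +-mono-≤ (*≤sum (λ x → subst (2 * C <_) (countTrue≡size (adj G x)) (≰⇒> (highX ∘ (x ,_)))))
              (*≤sum (λ y → subst (2 * C <_) (countTrue≡size (λ x → adj G x y)) (≰⇒> (highY ∘ (y ,_))))) ⟩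
    edges (adj G) + ∑[ y < n G ] ∑[ x < m G ] 𝟙 (adj G x y)
  ≡⟨ cong (edges (adj G) +_) (∑-comm (λ x y → 𝟙 (adj G x y))) ⟨
    edges (adj G) + edges (adj G)
  ≤⟨ +-mono-≤ few-edges few-edges ⟩
    C * (m G + n G) + C * (m G + n G)
  ≡⟨ doubling C (m G + n G) ⟩
    2 * C * (m G + n G) ∎)))
  where
  open ≤-Reasoning
  regroup : ∀ a b d → (a + b) + d * (a + b) ≡ a * suc d + b * suc d
  regroup = solve-∀

DEqAtMost⇒Sparse : ∀ {m n c} {M : Rel m n} t → DEqAtMost c M → Sparse t (3 ^ c * t) M
DEqAtMost⇒Sparse t (τ , depth≤c , eval≡M) =
  Sparse-mono (*-monoˡ-≤ t (^-monoʳ-≤ 3 depth≤c))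
    (Sparse-cong (λ x y → trans (∧-identityʳ _) (eval≡M x y)) (Sparse-eval τ (Sparse-complete t)))

boundedDEq⇒boundedDegeneracy : ∀ 𝒢 → WeaklySparse 𝒢 → BoundedDEq 𝒢 → BoundedDegeneracy 𝒢
boundedDEq⇒boundedDegeneracy 𝒢 (t , KttFree-𝒢) (c , shallow) =
  2 * (3 ^ c * t) , λ G G∈𝒢 nonempty →
    edges≤⇒lowDegreeVertex {3 ^ c * t} G nonempty
      (Sparse⇒edges≤ (DEqAtMost⇒Sparse t (shallow G G∈𝒢)) (KttFree-𝒢 G G∈𝒢))

-- Orientations

record Slots {k} (d : ℕ) (p : Fin k → Bool) : Set where
  field
    slot          : Fin d → Maybe (Fin k)
    slot-sound    : ∀ {i j} → slot i ≡ just j → T (p j)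
    slot-complete : ∀ {j} → T (p j) → ∃ λ i → slot i ≡ just j

slots : ∀ {k d} (p : Fin k → Bool) → countTrue p ≤ d → Slots d p
slots {zero} p _ = record
  { slot = λ _ → nothing ; slot-sound = λ () ; slot-complete = λ {j} → ⊥-elim (Fin.¬Fin0 j) }
slots {suc k} p count≤d with p zero in p₀
slots {suc k} {suc d} p (s≤s count≤d) | true = record
  { slot = slot′ ; slot-sound = λ {i} → sound′ {i} ; slot-complete = complete′ }
  where
  open Slots (slots (p ∘ suc) count≤d)
  slot′ : Fin (suc d) → Maybe (Fin (suc k))
  slot′ zero    = just zero
  slot′ (suc i) = Maybe.map suc (slot i)
  sound′ : ∀ {i j} → slot′ i ≡ just j → T (p j)
  sound′ {zero} refl = Equivalence.from T-≡ p₀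
  sound′ {suc i} eq with slot i in e | eq
  ... | just _  | refl = slot-sound e
  ... | nothing | ()
  complete′ : ∀ {j} → T (p j) → ∃ λ i → slot′ i ≡ just j
  complete′ {zero}  _   = zero , refl
  complete′ {suc j} pj with i , e ← slot-complete pj = suc i , cong (Maybe.map suc) e
slots {suc k} p count≤d | false = record
  { slot = Maybe.map suc ∘ slot ; slot-sound = λ {i} → sound′ {i} ; slot-complete = complete′ }
  where
  open Slots (slots (p ∘ suc) count≤d)
  sound′ : ∀ {i j} → Maybe.map suc (slot i) ≡ just j → T (p j)
  sound′ {i} eq with slot i in e | eq
  ... | just _  | refl = slot-sound e
  ... | nothing | ()
  complete′ : ∀ {j} → T (p j) → ∃ λ i → Maybe.map suc (slot i) ≡ just j
  complete′ {zero}  p0 = ⊥-elim (subst T p₀ p0)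
  complete′ {suc j} pj with i , e ← slot-complete pj = i , cong (Maybe.map suc) e

record Orientation (d : ℕ) (G : BGraph) : Set where
  field
    outX      : Fin d → Fin (m G) → Maybe (Fin (n G))
    outY      : Fin d → Fin (n G) → Maybe (Fin (m G))
    outX-edge : ∀ {i x y} → outX i x ≡ just y → T (adj G x y)
    outY-edge : ∀ {i x y} → outY i y ≡ just x → T (adj G x y)
    edge-out  : ∀ {x y} → T (adj G x y) → (∃ λ i → outX i x ≡ just y) ⊎ (∃ λ i → outY i y ≡ just x)

transpose : BGraph → BGraph
transpose G = mkBG (n G) (m G) (λ y x → adj G x y)

Orientation-transpose : ∀ {d G} → Orientation d G → Orientation d (transpose G)
Orientation-transpose O = record
  { outX = outY ; outY = outX
  ; outX-edge = outY-edge ; outY-edge = outX-edge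
  ; edge-out = Sum.swap ∘ edge-out }
  where open Orientation O

Orientation-noX : ∀ {d n} (E : Fin 0 → Fin n → Bool) → Orientation d (mkBG 0 n E)
Orientation-noX E = record
  { outX = λ _ () ; outY = λ _ _ → nothing
  ; outX-edge = λ {_} {x} → ⊥-elim (Fin.¬Fin0 x) ; outY-edge = λ ()
  ; edge-out = λ {x} → ⊥-elim (Fin.¬Fin0 x) }

Orientation-insertX : ∀ {d m n} (E : Fin (suc m) → Fin n → Bool) (x₀ : Fin (suc m)) →
  Slots d (E x₀) → Orientation d (mkBG m n (E ∘ punchIn x₀)) → Orientation d (mkBG (suc m) n E)
Orientation-insertX {d} {m} {n} E x₀ x₀-slots O = record
  { outX = λ i x → outX′ i x (x₀ Fin.≟ x)
  ; outY = outY′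
  ; outX-edge = λ {i} {x} → outX′-edge i x (x₀ Fin.≟ x)
  ; outY-edge = λ {i} → outY′-edge i
  ; edge-out = λ {x} → edge-out′ x (x₀ Fin.≟ x) }
  where
  open Slots x₀-slots
  open Orientation O
  outX′ : Fin d → (x : Fin (suc m)) → Dec (x₀ ≡ x) → Maybe (Fin n)
  outX′ i x (yes _)    = slot i
  outX′ i x (no x₀≢x) = outX i (punchOut x₀≢x)
  outY′ : Fin d → Fin n → Maybe (Fin (suc m))
  outY′ i y = Maybe.map (punchIn x₀) (outY i y)
  outX′-edge : ∀ i x x₀≟x {y} → outX′ i x x₀≟x ≡ just y → T (E x y)
  outX′-edge i x (yes refl) eq = slot-sound eq
  outX′-edge i x (no x₀≢x) {y} eq = subst (λ x → T (E x y)) (Fin.punchIn-punchOut x₀≢x) (outX-edge eq)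
  outY′-edge : ∀ i {x y} → outY′ i y ≡ just x → T (E x y)
  outY′-edge i {y = y} eq with outY i y in e | eq
  ... | just _  | refl = outY-edge e
  ... | nothing | ()
  edge-out′ : ∀ x x₀≟x {y} → T (E x y) →
              (∃ λ i → outX′ i x x₀≟x ≡ just y) ⊎ (∃ λ i → outY′ i y ≡ just x)
  edge-out′ x (yes refl) e = inj₁ (slot-complete e)
  edge-out′ x (no x₀≢x) {y} e with edge-out (subst (λ x → T (E x y)) (sym (Fin.punchIn-punchOut x₀≢x)) e)
  ... | inj₁ found    = inj₁ found
  ... | inj₂ (i , e′) =
    inj₂ (i , trans (cong (Maybe.map (punchIn x₀)) e′) (cong just (Fin.punchIn-punchOut x₀≢x)))

module _ {𝒢 : Class} {d : ℕ} (hereditary : Hereditary 𝒢)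
         (degenerate : ∀ G → 𝒢 G → 1 ≤ m G + n G → HasVertexOfDegreeAtMost d G) where

  private
    orient : ∀ N G → m G + n G ≤ N → 𝒢 G → Orientation d G
    orient N (mkBG zero n E) _ _ = Orientation-noX E
    orient N (mkBG (suc m) zero E) _ _ = Orientation-transpose (Orientation-noX λ y x → E x y)
    orient (suc N) G@(mkBG (suc m) (suc n) E) (s≤s size≤N) G∈𝒢 with degenerate G G∈𝒢 (s≤s z≤n)
    ... | inj₁ (x₀ , deg≤d) =
      Orientation-insertX E x₀ (slots (E x₀) deg≤d)
        (orient N _ size≤N (hereditary G (punchIn x₀) id (Fin.punchIn-injective x₀ _ _) id G∈𝒢))
    ... | inj₂ (y₀ , deg≤d) =
      Orientation-transpose (Orientation-insertX (λ y x → E x y) y₀ (slots (λ x → E x y₀) deg≤d)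
        (Orientation-transpose
          (orient N _ (subst (_≤ N) (+-suc m n) size≤N)
            (hereditary G id (punchIn y₀) id (Fin.punchIn-injective y₀ _ _) G∈𝒢))))

  boundedDegeneracy⇒orientation : ∀ G → 𝒢 G → Orientation d G
  boundedDegeneracy⇒orientation G = orient (m G + n G) G ≤-refl

-- Empty slots are coded by 0, the code of no vertex.
code : ∀ {k} → Maybe (Fin k) → ℕ
code nothing  = 0
code (just j) = suc (toℕ j)

code-injective : ∀ {k} → Injective _≡_ _≡_ (code {k})
code-injective {x = nothing} {nothing} _ = refl
code-injective {x = just i}  {just j}  e = cong just (Fin.toℕ-injective (suc-injective e))

anyEq : ∀ {k m n} → (Fin k → Fin m → ℕ) → (Fin k → Fin n → ℕ) → EqTree m n → EqTree m n
anyEq {zero}  α β τ = τ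
anyEq {suc k} α β τ = node (α zero) (β zero) (anyEq (α ∘ suc) (β ∘ suc) τ) (leaf true)

depth-anyEq : ∀ {k m n} α β (τ : EqTree m n) → depth (anyEq {k} α β τ) ≤ k + depth τ
depth-anyEq {zero}  α β τ = ≤-refl
depth-anyEq {suc k} α β τ =
  s≤s (≤-trans (≤-reflexive (⊔-identityʳ _)) (depth-anyEq (α ∘ suc) (β ∘ suc) τ))

eval-anyEq : ∀ {k m n} α β (τ : EqTree m n) x y →
             T (eval (anyEq {k} α β τ) x y) ⇔ ((∃ λ i → α i x ≡ β i y) ⊎ T (eval τ x y))
eval-anyEq {zero} α β τ x y = mk⇔ inj₂ λ { (inj₁ (() , _)) ; (inj₂ τxy) → τxy }
eval-anyEq {suc k} α β τ x y with α zero x ≟ β zero y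
... | yes α₀≡β₀ = mk⇔ (λ _ → inj₁ (zero , α₀≡β₀)) (λ _ → _)
... | no  α₀≢β₀ = mk⇔ (Sum.map₁ (λ (i , e) → suc i , e) ∘ Equivalence.to IH)
                      (Equivalence.from IH ∘ Sum.[ unshift , inj₂ ])
  where
  IH : T (eval (anyEq (α ∘ suc) (β ∘ suc) τ) x y) ⇔
       ((∃ λ i → α (suc i) x ≡ β (suc i) y) ⊎ T (eval τ x y))
  IH = eval-anyEq (α ∘ suc) (β ∘ suc) τ x y
  unshift : (∃ λ i → α i x ≡ β i y) → (∃ λ i → α (suc i) x ≡ β (suc i) y) ⊎ T (eval τ x y)
  unshift (zero  , e) = ⊥-elim (α₀≢β₀ e)
  unshift (suc i , e) = inj₁ (i , e)

T-⇔⇒≡ : ∀ {a b} → T a ⇔ T b → a ≡ b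
T-⇔⇒≡ {false} {false} _   = refl
T-⇔⇒≡ {false} {true}  a⇔b = ⊥-elim (Equivalence.from a⇔b _)
T-⇔⇒≡ {true}  {false} a⇔b = ⊥-elim (Equivalence.to a⇔b _)
T-⇔⇒≡ {true}  {true}  _   = refl

Orientation⇒DEqAtMost : ∀ {d G} → Orientation d G → DEqAtMost (d + d) (adj G)
Orientation⇒DEqAtMost {d} {G} O = τ , depth≤ , λ x y → T-⇔⇒≡ (mk⇔ (sound x y) (complete x y))
  where
  open Orientation O
  outCodeX idCodeX : Fin d → Fin (m G) → ℕ
  outCodeX i x = code (outX i x)
  idCodeX _ x = code (just x)
  idCodeY outCodeY : Fin d → Fin (n G) → ℕ
  idCodeY _ y = code (just y)
  outCodeY i y = code (outY i y)
  τY : EqTree (m G) (n G)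
  τY = anyEq idCodeX outCodeY (leaf false)
  τ : EqTree (m G) (n G)
  τ = anyEq outCodeX idCodeY τY
  depth≤ : depth τ ≤ d + d
  depth≤ = ≤-trans (depth-anyEq outCodeX idCodeY τY)
                   (+-monoʳ-≤ d (≤-trans (depth-anyEq idCodeX outCodeY (leaf false))
                                         (≤-reflexive (+-identityʳ d))))
  τ-spec : ∀ x y → T (eval τ x y) ⇔ ((∃ λ i → outCodeX i x ≡ idCodeY i y) ⊎ T (eval τY x y))
  τ-spec = eval-anyEq outCodeX idCodeY τY
  τY-spec : ∀ x y → T (eval τY x y) ⇔ ((∃ λ i → idCodeX i x ≡ outCodeY i y) ⊎ T false)
  τY-spec = eval-anyEq idCodeX outCodeY (leaf false)
  sound : ∀ x y → T (eval τ x y) → T (adj G x y)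
  sound x y τxy with Equivalence.to (τ-spec x y) τxy
  ... | inj₁ (i , e) = outX-edge (code-injective e)
  ... | inj₂ τYxy with Equivalence.to (τY-spec x y) τYxy
  ...   | inj₁ (i , e) = outY-edge (code-injective (sym e))
  complete : ∀ x y → T (adj G x y) → T (eval τ x y)
  complete x y e with edge-out e
  ... | inj₁ (i , e′) = Equivalence.from (τ-spec x y) (inj₁ (i , cong code e′))
  ... | inj₂ (i , e′) =
    Equivalence.from (τ-spec x y) (inj₂ (Equivalence.from (τY-spec x y) (inj₁ (i , cong code (sym e′)))))

boundedDegeneracy⇒boundedDEq : ∀ 𝒢 → Hereditary 𝒢 → BoundedDegeneracy 𝒢 → BoundedDEq 𝒢
boundedDegeneracy⇒boundedDEq 𝒢 hereditary (d , degenerate) =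
  d + d , λ G → Orientation⇒DEqAtMost ∘ boundedDegeneracy⇒orientation hereditary degenerate G

theorem1p5 : (𝒢 : Class) → Hereditary 𝒢 → WeaklySparse 𝒢 →
    (BoundedDEq 𝒢 ⇔ BoundedDegeneracy 𝒢)
theorem1p5 𝒢 hereditary weaklySparse =
  mk⇔ (boundedDEq⇒boundedDegeneracy 𝒢 weaklySparse) (boundedDegeneracy⇒boundedDEq 𝒢 hereditary)
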